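{- Let $m=2n+1\ge 5$ be odd and let $\varphi=(\mathcal A_1,\dots,\mathcal A_m)$ be a ring (as defined in the context). Then $\varphi$ is balanced if and only if the vertex set of its ring graph can be partitioned into exactly $m$ pairwise disjoint maximum independent sets $\pi^0_1,\dots,\pi^0_m$ with $\pi^0_i\in\Pi_i$ for all $i=1,\dots,m$.
   Context: Indices are taken cyclically modulo $m$. A ring is a sequence $\varphi=(\mathcal A_1,\dots,\mathcal A_m)$ of pairwise disjoint finite vertex sets such that $|\mathcal A_i|\ge 1$ and $|\mathcal A_i|+|\mathcal A_{i+1}|\le m$ for all $i$, and $\sum_{i=1}^m|\mathcal A_i| = m\lfloor m/2\rfloor$; it is balanced if $|\mathcal A_i|=n$ for all $i$. The ring graph has vertex set $\bigcup_i\mathcal A_i$, two distinct vertices $u\in\mathcal A_i$, $v\in\mathcal A_j$ being adjacent iff $j\in\{i-1,i,i+1\}$ mod $m$; maximum independent sets have size $n$. For $i=1,\dots,m$, $\Pi_i$ is the family of all sets $\{v_0,\dots,v_{n-1}\}$ with $v_k\in\mathcal A_{i+2k}$ for $k=0,\dots,n-1$. -}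

module Defs where

open import Data.Nat using (ℕ; suc; _+_; _*_; _≤_; _/_)
open import Data.Nat.DivMod using (_mod_)
open import Data.Nat.ListAction using (sum)
open import Data.Fin using (Fin; toℕ)
open import Data.List using (tabulate)
open import Data.Product using (Σ; ∃; ∃-syntax; _×_; _,_)
open import Relation.Binary.PropositionalEquality using (_≡_)

-- Throughout, n is a natural number and the number of classes is
-- m = 2n+1 (odd).  Classes are indexed 0-based by Fin m, and all index
-- arithmetic is modulo m.
ringSize : ℕ → ℕ
ringSize n = suc (2 * n)

shift : (n : ℕ) → Fin (ringSize n) → ℕ → Fin (ringSize n)
shift n i j = (toℕ i + j) mod ringSize n

-- A family of pairwise disjoint finite sets (A_1,...,A_m) is represented,
-- up to renaming of vertices, by its sizes a : Fin m → ℕ; the class A_i is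
-- {i} × Fin (a i), so the classes are automatically pairwise disjoint.
Sizes : ℕ → Set
Sizes n = Fin (ringSize n) → ℕ

Vertex : (n : ℕ) → Sizes n → Set
Vertex n a = Σ (Fin (ringSize n)) (λ i → Fin (a i))

IsRing : (n : ℕ) → Sizes n → Set
IsRing n a =
  ((i : Fin (ringSize n)) → 1 ≤ a i) ×
  ((i : Fin (ringSize n)) → a i + a (shift n i 1) ≤ ringSize n) ×
  (sum (tabulate a) ≡ ringSize n * (ringSize n / 2))

IsBalanced : (n : ℕ) → Sizes n → Set
IsBalanced n a = (i : Fin (ringSize n)) → a i ≡ n

-- A member of Π_i: a choice of v_k ∈ A_{i+2k} for k = 0,...,n-1.
Π-choice : (n : ℕ) → Sizes n → Fin (ringSize n) → Set
Π-choice n a i = (k : Fin n) → Fin (a (shift n i (2 * toℕ k)))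

InΠ : (n : ℕ) (a : Sizes n) (i : Fin (ringSize n)) →
      Π-choice n a i → Vertex n a → Set
InΠ n a i σ v = ∃[ k ] (_≡_ {A = Vertex n a} (shift n i (2 * toℕ k) , σ k) v)

HasΠPartition : (n : ℕ) → Sizes n → Set
HasΠPartition n a =
  Σ ((i : Fin (ringSize n)) → Π-choice n a i) λ π →
    ((i j : Fin (ringSize n)) (v : Vertex n a) →
       InΠ n a i (π i) v → InΠ n a j (π j) v → i ≡ j) ×
    ((v : Vertex n a) → ∃[ i ] (InΠ n a i (π i) v))

{-# OPTIONS --safe #-}
-- If every class has n vertices, let π_i consist of the k-th vertex of
-- A_{i+2k} for each k; the k-th vertex of A_c then lies in π_{c-2k} and in no
-- other π_j.  Conversely, sending a vertex of A_c to its position k in a set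
-- π_i containing it is injective, because c and k determine i; hence
-- |A_c| ≤ n, and since the class sizes add up to m n, all of them equal n.
module Submission where

open import Defs
open import Data.Nat using (ℕ; suc; _+_; _*_; _≤_; _/_; _%_; NonZero)
open import Data.Nat.Properties
open import Data.Nat.DivMod
open import Data.Nat.Divisibility using (divides-refl)
open import Data.Nat.ListAction using (sum)
open import Data.Fin using (Fin; toℕ; cast) renaming (zero to fzero; suc to fsuc)
open import Data.Fin.Properties using (toℕ-injective; toℕ-fromℕ<; toℕ-cast; toℕ<n; injective⇒≤)
open import Data.List using (tabulate)
open import Data.Product using (∃-syntax; _×_; _,_; proj₁; proj₂)
open import Function using (_∘_; _⇔_; mk⇔)
open import Relation.Binary.PropositionalEquality

[m%d+n]%d≡[m+n]%d : ∀ m n d .{{_ : NonZero d}} → (m % d + n) % d ≡ (m + n) % d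
[m%d+n]%d≡[m+n]%d m n d = begin
  (m % d + n) % d            ≡⟨ %-distribˡ-+ (m % d) n d ⟩
  (m % d % d + n % d) % d    ≡⟨ cong (λ r → (r + n % d) % d) (m%n%n≡m%n m d) ⟩
  (m % d + n % d) % d        ≡⟨ %-distribˡ-+ m n d ⟨
  (m + n) % d                ∎
  where open ≡-Reasoning

ringSize/2≡n : ∀ n → ringSize n / 2 ≡ n
ringSize/2≡n n = begin
  suc (2 * n) / 2    ≡⟨ /-congˡ {o = 2} (cong suc (*-comm 2 n)) ⟩
  (1 + n * 2) / 2    ≡⟨ +-distrib-/-∣ʳ 1 {d = 2} (divides-refl n) ⟩
  1 / 2 + n * 2 / 2  ≡⟨ m*n/n≡m n 2 ⟩
  n                  ∎
  where open ≡-Reasoning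

+-≤-≡⇒≡ : ∀ {x y b c} → x ≤ b → y ≤ c → x + y ≡ b + c → x ≡ b × y ≡ c
+-≤-≡⇒≡ {x} {y} {b} {c} x≤b y≤c x+y≡b+c =
  x≡b , +-cancelˡ-≡ x y c (trans x+y≡b+c (cong (_+ c) (sym x≡b)))
  where
  x≡b : x ≡ b
  x≡b = ≤-antisym x≤b (+-cancelʳ-≤ c b x (subst (_≤ x + c) x+y≡b+c (+-monoʳ-≤ x y≤c)))

sum-tabulate-≤ : ∀ {k b} (f : Fin k → ℕ) → (∀ i → f i ≤ b) → sum (tabulate f) ≤ k * b
sum-tabulate-≤ {0}     f f≤b = ≤-refl
sum-tabulate-≤ {suc k} f f≤b = +-mono-≤ (f≤b fzero) (sum-tabulate-≤ (f ∘ fsuc) (f≤b ∘ fsuc))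

sum-tabulate-≡-max : ∀ {k b} (f : Fin k → ℕ) → (∀ i → f i ≤ b) →
                     sum (tabulate f) ≡ k * b → ∀ i → f i ≡ b
sum-tabulate-≡-max {suc k} f f≤b sum≡ i
  with +-≤-≡⇒≡ (f≤b fzero) (sum-tabulate-≤ (f ∘ fsuc) (f≤b ∘ fsuc)) sum≡
sum-tabulate-≡-max f f≤b sum≡ fzero    | head≡ , _     = head≡
sum-tabulate-≡-max f f≤b sum≡ (fsuc i) | _     , rest≡ = sum-tabulate-≡-max (f ∘ fsuc) (f≤b ∘ fsuc) rest≡ i

module _ (n : ℕ) where
  private
    m : ℕ
    m = ringSize n

  toℕ-shift : ∀ i x → toℕ (shift n i x) ≡ (toℕ i + x) % m
  toℕ-shift i x = toℕ-fromℕ< (m%n<n (toℕ i + x) m)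

  shift-+ : ∀ i x y → shift n (shift n i x) y ≡ shift n i (x + y)
  shift-+ i x y = toℕ-injective (begin
    toℕ (shift n (shift n i x) y)  ≡⟨ toℕ-shift (shift n i x) y ⟩
    (toℕ (shift n i x) + y) % m    ≡⟨ cong (λ r → (r + y) % m) (toℕ-shift i x) ⟩
    ((toℕ i + x) % m + y) % m      ≡⟨ [m%d+n]%d≡[m+n]%d (toℕ i + x) y m ⟩
    (toℕ i + x + y) % m            ≡⟨ cong (_% m) (+-assoc (toℕ i) x y) ⟩
    (toℕ i + (x + y)) % m          ≡⟨ toℕ-shift i (x + y) ⟨
    toℕ (shift n i (x + y))        ∎)
    where open ≡-Reasoning

  shift-*ringSize : ∀ i k → shift n i (k * m) ≡ i
  shift-*ringSize i k = toℕ-injective (begin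
    toℕ (shift n i (k * m))  ≡⟨ toℕ-shift i (k * m) ⟩
    (toℕ i + k * m) % m      ≡⟨ [m+kn]%n≡m%n (toℕ i) k m ⟩
    toℕ i % m                ≡⟨ m<n⇒m%n≡m (toℕ<n i) ⟩
    toℕ i                    ∎)
    where open ≡-Reasoning

  unshift : ℕ → ℕ
  unshift x = x * (2 * n)

  shift-unshift : ∀ i x → shift n (shift n i x) (unshift x) ≡ i
  shift-unshift i x = begin
    shift n (shift n i x) (unshift x)  ≡⟨ shift-+ i x (unshift x) ⟩
    shift n i (x + x * (2 * n))        ≡⟨ cong (shift n i) (*-suc x (2 * n)) ⟨
    shift n i (x * m)                  ≡⟨ shift-*ringSize i x ⟩
    i                                  ∎
    where open ≡-Reasoning

  unshift-shift : ∀ i x → shift n (shift n i (unshift x)) x ≡ i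
  unshift-shift i x = begin
    shift n (shift n i (unshift x)) x  ≡⟨ shift-+ i (unshift x) x ⟩
    shift n i (unshift x + x)          ≡⟨ cong (shift n i) (+-comm (unshift x) x) ⟩
    shift n i (x + unshift x)          ≡⟨ shift-+ i x (unshift x) ⟨
    shift n (shift n i x) (unshift x)  ≡⟨ shift-unshift i x ⟩
    i                                  ∎
    where open ≡-Reasoning

  shift-injective : ∀ i j x → shift n i x ≡ shift n j x → i ≡ j
  shift-injective i j x eq = begin
    i                                  ≡⟨ shift-unshift i x ⟨
    shift n (shift n i x) (unshift x)  ≡⟨ cong (λ l → shift n l (unshift x)) eq ⟩
    shift n (shift n j x) (unshift x)  ≡⟨ shift-unshift j x ⟩
    j                                  ∎
    where open ≡-Reasoning

module Vertices (n : ℕ) (a : Sizes n) where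
  slot : Vertex n a → ℕ
  slot (_ , t) = toℕ t

  Vertex-≡ : ∀ {c c'} {t : Fin (a c)} {t' : Fin (a c')} →
             c ≡ c' → toℕ t ≡ toℕ t' → _≡_ {A = Vertex n a} (c , t) (c' , t')
  Vertex-≡ refl eq = cong (_ ,_) (toℕ-injective eq)

  member : (i : Fin (ringSize n)) → Π-choice n a i → Fin n → Vertex n a
  member i σ k = shift n i (2 * toℕ k) , σ k

module _ (n : ℕ) (a : Sizes n) (balanced : IsBalanced n a) where
  open Vertices n a

  diagonalΠ : (i : Fin (ringSize n)) → Π-choice n a i
  diagonalΠ i k = cast (sym (balanced _)) k

  slot-member-diagonalΠ : ∀ i k → slot (member i (diagonalΠ i) k) ≡ toℕ k
  slot-member-diagonalΠ i k = toℕ-cast _ k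

  diagonalΠ-disjoint : ∀ i j v → InΠ n a i (diagonalΠ i) v → InΠ n a j (diagonalΠ j) v → i ≡ j
  diagonalΠ-disjoint i j v (k , refl) (k' , eq)
    with toℕ-injective (trans (sym (slot-member-diagonalΠ j k'))
                              (trans (cong slot eq) (slot-member-diagonalΠ i k)))
  ... | refl = sym (shift-injective n j i (2 * toℕ k) (cong proj₁ eq))

  diagonalΠ-cover : ∀ v → ∃[ i ] InΠ n a i (diagonalΠ i) v
  diagonalΠ-cover (c , t) = shift n c (unshift n (2 * toℕ k)) , k ,
    Vertex-≡ (unshift-shift n c (2 * toℕ k)) (trans (toℕ-cast _ k) (toℕ-cast _ t))
    where
    k : Fin n
    k = cast (balanced c) t

  balanced⇒ΠPartition : HasΠPartition n a
  balanced⇒ΠPartition = diagonalΠ , diagonalΠ-disjoint , diagonalΠ-cover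

module _ (n : ℕ) (a : Sizes n) (π : (i : Fin (ringSize n)) → Π-choice n a i) where
  open Vertices n a

  position : ∀ {v} → ∃[ i ] InΠ n a i (π i) v → Fin n
  position (_ , k , _) = k

  position-injective : ∀ {c} {t t' : Fin (a c)}
    (d : ∃[ i ] InΠ n a i (π i) (c , t)) (d' : ∃[ i ] InΠ n a i (π i) (c , t')) →
    position d ≡ position d' → t ≡ t'
  position-injective (i , k , eq) (j , .k , eq') refl
    with shift-injective n i j (2 * toℕ k) (trans (cong proj₁ eq) (sym (cong proj₁ eq')))
  ... | refl = toℕ-injective (trans (sym (cong slot eq)) (cong slot eq'))

  ΠCover⇒size≤n : (∀ v → ∃[ i ] InΠ n a i (π i) v) → ∀ c → a c ≤ n
  ΠCover⇒size≤n cover c =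
    injective⇒≤ {f = λ t → position (cover (c , t))} (position-injective (cover _) (cover _))

ΠPartition⇒balanced : (n : ℕ) (a : Sizes n) →
  sum (tabulate a) ≡ ringSize n * (ringSize n / 2) → HasΠPartition n a → IsBalanced n a
ΠPartition⇒balanced n a sum≡ (π , _ , cover) =
  sum-tabulate-≡-max a (ΠCover⇒size≤n n a π cover) (trans sum≡ (cong (ringSize n *_) (ringSize/2≡n n)))

proposition2p11 : (n : ℕ) → 2 ≤ n → (a : Sizes n) → IsRing n a →
    (IsBalanced n a ⇔ HasΠPartition n a)
proposition2p11 n _ a (_ , _ , sum≡) =
  mk⇔ (balanced⇒ΠPartition n a) (ΠPartition⇒balanced n a sum≡)
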